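{- Let $(\mathcal{S}^x,H)$ be a finite thick STGQ with group of symmetries $\mathbb{S}$ and Kantor family $(\mathcal{F},\mathcal{F}^*)$. Then $(\mathcal{S}^x,H)$ satisfies property (*) if and only if $H/\mathbb{S}$ is abelian. If one of these equivalent conditions holds, every member of $\mathcal{F}$ is abelian.
   Context: A finite GQ of order $(s,t)$: every line has $s+1$ points, every point lies on $t+1$ lines, and for each point $p$ and line $L$ not through $p$ exactly one point of $L$ is collinear with $p$; thick means $s,t\ge2$. An EGQ $(\mathcal{S}^x,H)$: $H\le\mathrm{Aut}(\mathcal{S})$ fixes every line through $x$ and acts sharply transitively on the points not collinear with $x$ (affine points). A symmetry with center $x$ fixes every point collinear with $x$; an STGQ is an EGQ of order $(s,t)$ whose elation group contains a group $\mathbb{S}$ of $t$ symmetries with center $x$. Kantor family: fix an affine point $z$, let $U_0,\dots,U_t$ be the lines through $z$ and $u_i$ the point of $U_i$ collinear with $x$; $\mathcal{F}=\{H_{U_i}\}$, $\mathcal{F}^*=\{H_{u_i}\}$. Property (*): whenever an element of $H$ fixes a point $y\ne x$ collinear with $x$, it fixes every point of the line $xy$. -}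

module Defs where

open import Level using (Level; _⊔_)
open import Data.Nat using (ℕ; zero; suc; _+_; _≤_)
open import Data.Fin using (Fin)
open import Data.Bool using (Bool; true; false; _∧_; _∨_; if_then_else_)
open import Data.Product using (Σ; _×_; _,_; ∃; ∃-syntax)
open import Relation.Binary.PropositionalEquality using (_≡_; _≢_)
open import Algebra.Bundles using (Group)

count : ∀ {n} → (Fin n → Bool) → ℕ
count {zero}  f = 0
count {suc n} f = (if f Fin.zero then 1 else 0) + count (λ i → f (Fin.suc i))

anyFin : ∀ {n} → (Fin n → Bool) → Bool
anyFin {zero}  f = false
anyFin {suc n} f = f Fin.zero ∨ anyFin (λ i → f (Fin.suc i))

-- p and q are collinear: some line is incident with both
-- (in particular every point is collinear with itself)
collinear : ∀ {np nl} → (Fin np → Fin nl → Bool) → Fin np → Fin np → Bool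
collinear I p q = anyFin (λ L → I p L ∧ I q L)

record GQ (np nl s t : ℕ) : Set where
  field
    I : Fin np → Fin nl → Bool
    partialLinear : ∀ p q L M → p ≢ q →
      I p L ≡ true → I q L ≡ true → I p M ≡ true → I q M ≡ true → L ≡ M
    linePoints : ∀ L → count (λ p → I p L) ≡ suc s
    pointLines : ∀ p → count (λ L → I p L) ≡ suc t
    gqAxiom : ∀ p L → I p L ≡ false →
      count (λ q → I q L ∧ collinear I p q) ≡ 1

Thick : ∀ {np nl} (s t : ℕ) → GQ np nl s t → Set
Thick s t _ = 2 ≤ s × 2 ≤ t

-- A (faithful) action of a group on the GQ by automorphisms,
-- i.e. the group is (identified with) a subgroup of Aut(S).

record Action {np nl s t c ℓ} (S : GQ np nl s t) (G : Group c ℓ) : Set (c ⊔ ℓ) where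
  open GQ S
  open Group G
  field
    actP : Carrier → Fin np → Fin np
    actL : Carrier → Fin nl → Fin nl
    actP-cong : ∀ {g h} → g ≈ h → ∀ p → actP g p ≡ actP h p
    actL-cong : ∀ {g h} → g ≈ h → ∀ L → actL g L ≡ actL h L
    actP-ε : ∀ p → actP ε p ≡ p
    actL-ε : ∀ L → actL ε L ≡ L
    actP-∙ : ∀ g h p → actP (g ∙ h) p ≡ actP g (actP h p)
    actL-∙ : ∀ g h L → actL (g ∙ h) L ≡ actL g (actL h L)
    preservesI : ∀ g p L → I (actP g p) (actL g L) ≡ I p L
    faithful : ∀ g → (∀ p → actP g p ≡ p) → (∀ L → actL g L ≡ L) → g ≈ ε

module _ {np nl s t c ℓ} {S : GQ np nl s t} {G : Group c ℓ}
         (A : Action S G) (x : Fin np) where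
  open GQ S
  open Group G
  open Action A

  Affine : Fin np → Set
  Affine y = collinear I x y ≡ false

  record IsElationGroup : Set (c ⊔ ℓ) where
    field
      fixesLinesOnX : ∀ g L → I x L ≡ true → actL g L ≡ L
      sharplyTransitive : ∀ y z → Affine y → Affine z →
        Σ Carrier λ g → actP g y ≡ z × (∀ h → actP h y ≡ z → h ≈ g)

  IsSymmetry : Carrier → Set
  IsSymmetry g = ∀ y → collinear I x y ≡ true → actP g y ≡ y

  HasSize : ∀ {ℓ'} → (Carrier → Set ℓ') → ℕ → Set (c ⊔ ℓ ⊔ ℓ')
  HasSize P n = Σ (Fin n → Carrier) λ f →
      (∀ i → P (f i))
    × (∀ i j → f i ≈ f j → i ≡ j)
    × (∀ g → P g → ∃[ i ] (g ≈ f i))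

  record IsSymmetryGroup {ℓ'} (𝕊 : Carrier → Set ℓ') : Set (c ⊔ ℓ ⊔ ℓ') where
    field
      respects : ∀ {g h} → g ≈ h → 𝕊 g → 𝕊 h
      hasε : 𝕊 ε
      closed∙ : ∀ {g h} → 𝕊 g → 𝕊 h → 𝕊 (g ∙ h)
      closed⁻¹ : ∀ {g} → 𝕊 g → 𝕊 (g ⁻¹)
      symmetries : ∀ {g} → 𝕊 g → IsSymmetry g
      order : HasSize 𝕊 t

  PropertyStar : Set c
  PropertyStar = ∀ g y → y ≢ x → collinear I x y ≡ true → actP g y ≡ y →
    ∀ L → I x L ≡ true → I y L ≡ true → ∀ w → I w L ≡ true → actP g w ≡ w

  -- H/𝕊 is abelian: gS·hS = hS·gS, i.e. (h g)⁻¹ (g h) ∈ 𝕊 for all g, h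
  QuotientAbelian : ∀ {ℓ'} → (Carrier → Set ℓ') → Set (c ⊔ ℓ')
  QuotientAbelian 𝕊 = ∀ g h → 𝕊 ((h ∙ g) ⁻¹ ∙ (g ∙ h))

  Stab : Fin nl → Carrier → Set
  Stab U g = actL g U ≡ U

  AbelianSub : ∀ {ℓ'} → (Carrier → Set ℓ') → Set (c ⊔ ℓ ⊔ ℓ')
  AbelianSub P = ∀ g h → P g → P h → g ∙ h ≈ h ∙ g

  -- every member H_{U_i} of the Kantor family F (w.r.t. the affine base
  -- point z; U_0..U_t are the lines through z) is abelian
  KantorFamilyAbelian : Fin np → Set (c ⊔ ℓ)
  KantorFamilyAbelian z = ∀ U → I z U ≡ true → AbelianSub (Stab U)

module Submission where

-- Write [g,h] = (hg)⁻¹(gh), so "H/𝕊 abelian" means [g,h] ∈ 𝕊 for all g, h.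
-- Since 𝕊 consists of symmetries about x, such g and h commute on x^⊥.
--
--  * Counting over Fin relates the function `count` of Defs to injections;
--    it yields existence and uniqueness of projections in the GQ and the
--    one genuinely combinatorial step below.
--  * General facts: basic GQ geometry, automorphism actions, and elation
--    groups (they fix x, preserve x^⊥, act semiregularly on affine points).
--  * H/𝕊 abelian ⇒ (*): if g fixes y ∈ x^⊥, move y to any w on xy by some h;
--    then g w = g h y = h g y = w.
--  * H/𝕊 abelian ⇒ H_U abelian: [g,h] ∈ H_U fixes a point of x^⊥ off U,
--    hence fixes the affine point z on U, hence is trivial.
--  * (*) ⇒ H/𝕊 abelian: take an affine z and three lines U_p through z with
--    projections u_p ∈ x^⊥.  Counting lines through u_p gives
--    H_{u_p} ∩ H_{u_q} ⊆ 𝕊.  Under (*) this makes H_{u_p} and H_{u_q} commute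
--    on x^⊥, from which g h u_p = h g u_p; so [g,h] fixes u_1, u_2 and lies in 𝕊.

open import Defs
open import Level using (Level)
open import Data.Nat using (ℕ; suc; _≤_; s≤s)
open import Data.Nat.Properties using (n≮n; <⇒≱; ≤-trans; n≤1+n)
open import Data.Fin using (Fin; zero; suc)
open import Data.Fin.Properties using (_≟_; any?; injective⇒≤; suc-injective)
open import Data.Vec.Functional using (_∷_; [])
open import Data.Bool using (Bool; true; false; _∧_) renaming (_≟_ to _≟ᵇ_)
open import Data.Bool.Properties using (¬-not)
open import Data.Product using (_×_; _,_; ∃-syntax; proj₁; proj₂)
open import Data.Sum using (_⊎_; [_,_]′)
open import Data.Empty using (⊥; ⊥-elim)
open import Function using (_∘_)
open import Function.Bundles using (_⇔_; mk⇔)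
open import Function.Definitions using (Injective)
open import Relation.Nullary using (¬_; yes; no)
open import Relation.Nullary.Decidable using (_×-dec_; ¬?)
open import Relation.Binary.PropositionalEquality
open import Algebra.Bundles using (Group)
import Algebra.Properties.Group as GroupProperties

clash : ∀ {b} → b ≡ false → b ≡ true → ⊥
clash refl ()

∧-intro : ∀ {a b} → a ≡ true → b ≡ true → a ∧ b ≡ true
∧-intro refl refl = refl

∧-elim : ∀ {a b} → a ∧ b ≡ true → a ≡ true × b ≡ true
∧-elim {true} {true} _ = refl , refl

anyFin-intro : ∀ {n} (f : Fin n → Bool) i → f i ≡ true → anyFin f ≡ true
anyFin-intro f zero e rewrite e = refl
anyFin-intro f (suc i) e with f zero
... | true = refl
... | false = anyFin-intro (f ∘ suc) i e

anyFin-elim : ∀ {n} (f : Fin n → Bool) → anyFin f ≡ true → ∃[ i ] f i ≡ true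
anyFin-elim {suc n} f e with f zero in f0
... | true = zero , f0
... | false with anyFin-elim (f ∘ suc) e
...   | i , fi = suc i , fi

-- The existence lemmas built from searches are sealed (`opaque`): only their
-- types matter, and letting the type checker unfold the searches is very costly.

enumerate : ∀ {n} (P : Fin n → Bool) → Fin (count P) → Fin n
enumerate {suc n} P i with P zero
enumerate {suc n} P zero    | true = zero
enumerate {suc n} P (suc i) | true = suc (enumerate (P ∘ suc) i)
enumerate {suc n} P i       | false = suc (enumerate (P ∘ suc) i)

enumerate-sound : ∀ {n} (P : Fin n → Bool) i → P (enumerate P i) ≡ true
enumerate-sound {suc n} P i with P zero in P0
enumerate-sound {suc n} P zero    | true = P0
enumerate-sound {suc n} P (suc i) | true = enumerate-sound (P ∘ suc) i
enumerate-sound {suc n} P i       | false = enumerate-sound (P ∘ suc) i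

enumerate-injective : ∀ {n} (P : Fin n → Bool) → Injective _≡_ _≡_ (enumerate P)
enumerate-injective {suc n} P {i} {j} e with P zero
enumerate-injective {suc n} P {zero}  {zero}  e  | true = refl
enumerate-injective {suc n} P {zero}  {suc j} () | true
enumerate-injective {suc n} P {suc i} {zero}  () | true
enumerate-injective {suc n} P {suc i} {suc j} e  | true =
  cong suc (enumerate-injective (P ∘ suc) (suc-injective e))
enumerate-injective {suc n} P {i} {j} e | false =
  enumerate-injective (P ∘ suc) (suc-injective e)

enumerate-complete : ∀ {n} (P : Fin n → Bool) b → P b ≡ true → ∃[ i ] enumerate P i ≡ b
enumerate-complete {suc n} P b Pb with P zero in P0
enumerate-complete {suc n} P zero    Pb | true = zero , refl
enumerate-complete {suc n} P (suc b) Pb | true with enumerate-complete (P ∘ suc) b Pb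
... | i , e = suc i , cong suc e
enumerate-complete {suc n} P zero    Pb | false = ⊥-elim (clash P0 Pb)
enumerate-complete {suc n} P (suc b) Pb | false with enumerate-complete (P ∘ suc) b Pb
... | i , e = i , cong suc e

opaque
  count-nonzero : ∀ {n} (P : Fin n → Bool) {k} → count P ≡ suc k → ∃[ b ] P b ≡ true
  count-nonzero P e = enumerate P (subst Fin (sym e) zero) , enumerate-sound P _

injection⇒≤count : ∀ {k n} (P : Fin n → Bool) (h : Fin k → Fin n) →
  Injective _≡_ _≡_ h → (∀ i → P (h i) ≡ true) → k ≤ count P
injection⇒≤count {k} P h h-inj hP = injective⇒≤ index-injective
  where
  index : Fin k → Fin (count P)
  index i = proj₁ (enumerate-complete P (h i) (hP i))
  index-injective : Injective _≡_ _≡_ index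
  index-injective {i} {j} e = h-inj (begin
    h i                   ≡⟨ sym (proj₂ (enumerate-complete P (h i) (hP i))) ⟩
    enumerate P (index i) ≡⟨ cong (enumerate P) e ⟩
    enumerate P (index j) ≡⟨ proj₂ (enumerate-complete P (h j) (hP j)) ⟩
    h j                   ∎)
    where open ≡-Reasoning

covered⇒count≤ : ∀ {m n} (P : Fin n → Bool) (xs : Fin m → Fin n) →
  (∀ b → P b ≡ true → ∃[ j ] xs j ≡ b) → count P ≤ m
covered⇒count≤ {m} P xs cover = injective⇒≤ preimage-injective
  where
  preimage : Fin (count P) → Fin m
  preimage i = proj₁ (cover (enumerate P i) (enumerate-sound P i))
  preimage-injective : Injective _≡_ _≡_ preimage
  preimage-injective {i} {j} e = enumerate-injective P (begin
    enumerate P i       ≡⟨ sym (proj₂ (cover (enumerate P i) (enumerate-sound P i))) ⟩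
    xs (preimage i)     ≡⟨ cong xs e ⟩
    xs (preimage j)     ≡⟨ proj₂ (cover (enumerate P j) (enumerate-sound P j)) ⟩
    enumerate P j       ∎)
    where open ≡-Reasoning

opaque
  avoid : ∀ {m n} (P : Fin n → Bool) (xs : Fin m → Fin n) → suc m ≤ count P →
    ∃[ b ] (P b ≡ true × ¬ (∃[ i ] xs i ≡ b))
  avoid P xs large with any? (λ b → (P b ≟ᵇ true) ×-dec ¬? (any? (λ i → xs i ≟ b)))
  ... | yes found = found
  ... | no none = ⊥-elim (<⇒≱ large (covered⇒count≤ P xs cover))
    where
    cover : ∀ b → P b ≡ true → ∃[ j ] xs j ≡ b
    cover b Pb with any? (λ i → xs i ≟ b)
    ... | yes hit = hit
    ... | no miss = ⊥-elim (none (b , Pb , miss))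

opaque
  injection⇒onto : ∀ {k n} (P : Fin n → Bool) (h : Fin k → Fin n) →
    Injective _≡_ _≡_ h → (∀ i → P (h i) ≡ true) → count P ≡ k →
    ∀ b → P b ≡ true → ∃[ i ] h i ≡ b
  injection⇒onto {k} P h h-inj hP size b Pb with any? (λ i → h i ≟ b)
  ... | yes hit = hit
  ... | no miss = ⊥-elim (n≮n k (subst (suc k ≤_) size
                    (injection⇒≤count P (b ∷ h) extended-injective extended-in-P)))
    where
    extended-injective : Injective _≡_ _≡_ (b ∷ h)
    extended-injective {zero}  {zero}  _ = refl
    extended-injective {zero}  {suc j} e = ⊥-elim (miss (j , sym e))
    extended-injective {suc i} {zero}  e = ⊥-elim (miss (i , e))
    extended-injective {suc i} {suc j} e = cong suc (h-inj e)
    extended-in-P : ∀ i → P ((b ∷ h) i) ≡ true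
    extended-in-P zero = Pb
    extended-in-P (suc i) = hP i

count≡1⇒unique : ∀ {n} (P : Fin n → Bool) → count P ≡ 1 →
  ∀ a b → P a ≡ true → P b ≡ true → a ≡ b
count≡1⇒unique P single a b Pa Pb =
  proj₂ (injection⇒onto P (λ _ → a) constant-injective (λ _ → Pa) single b Pb)
  where
  constant-injective : Injective _≡_ _≡_ (λ (_ : Fin 1) → a)
  constant-injective {zero} {zero} _ = refl

module Geometry {np nl s t} (S : GQ np nl s t) where
  open GQ S

  col : Fin np → Fin np → Bool
  col = collinear I

  collinear-intro : ∀ {p q} L → I p L ≡ true → I q L ≡ true → col p q ≡ true
  collinear-intro {p} {q} L pL qL = anyFin-intro (λ L → I p L ∧ I q L) L (∧-intro pL qL)

  collinear-elim : ∀ {p q} → col p q ≡ true → ∃[ L ] (I p L ≡ true × I q L ≡ true)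
  collinear-elim {p} {q} e with anyFin-elim (λ L → I p L ∧ I q L) e
  ... | L , pqL = L , ∧-elim pqL

  collinear-sym : ∀ {p q} → col p q ≡ true → col q p ≡ true
  collinear-sym e with collinear-elim e
  ... | L , pL , qL = collinear-intro L qL pL

  apart : ∀ {p q L} → col p q ≡ false → I p L ≡ true → I q L ≡ false
  apart {L = L} pq pL = ¬-not (λ qL → clash pq (collinear-intro L pL qL))

  apart˘ : ∀ {p q L} → col p q ≡ false → I q L ≡ true → I p L ≡ false
  apart˘ {L = L} pq qL = ¬-not (λ pL → clash pq (collinear-intro L pL qL))

  projection-exists : ∀ p L → I p L ≡ false → ∃[ q ] (I q L ≡ true × col p q ≡ true)
  projection-exists p L pL with count-nonzero (λ q → I q L ∧ col p q) (gqAxiom p L pL)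
  ... | q , e = q , ∧-elim e

  projection-unique : ∀ p L → I p L ≡ false → ∀ q q' →
    I q L ≡ true → col p q ≡ true → I q' L ≡ true → col p q' ≡ true → q ≡ q'
  projection-unique p L pL q q' qL pq q'L pq' =
    count≡1⇒unique (λ q → I q L ∧ col p q) (gqAxiom p L pL) q q' (∧-intro qL pq) (∧-intro q'L pq')

  someLine : ∀ p → ∃[ L ] I p L ≡ true
  someLine p = count-nonzero (I p) (pointLines p)

  otherLine : 1 ≤ t → ∀ p L → ∃[ N ] (I p N ≡ true × N ≢ L)
  otherLine t≥1 p L with avoid (I p) (λ _ → L) (subst (2 ≤_) (sym (pointLines p)) (s≤s t≥1))
  ... | N , pN , miss = N , pN , λ e → miss (zero , sym e)

  otherPoint : 1 ≤ s → ∀ L p → ∃[ q ] (I q L ≡ true × q ≢ p)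
  otherPoint s≥1 L p with avoid (λ q → I q L) (λ _ → p) (subst (2 ≤_) (sym (linePoints L)) (s≤s s≥1))
  ... | q , qL , miss = q , qL , λ e → miss (zero , sym e)

  threeLines : 2 ≤ t → ∀ p → ∃[ U₁ ] ∃[ U₂ ] ∃[ U₃ ]
    (I p U₁ ≡ true × I p U₂ ≡ true × I p U₃ ≡ true × U₁ ≢ U₂ × U₂ ≢ U₃ × U₁ ≢ U₃)
  threeLines t≥2 p with someLine p
  ... | U₁ , pU₁ with otherLine (≤-trans (n≤1+n 1) t≥2) p U₁
  ... | U₂ , pU₂ , U₂≢U₁ with avoid (I p) (U₁ ∷ U₂ ∷ [])
                                (subst (3 ≤_) (sym (pointLines p)) (s≤s t≥2))
  ... | U₃ , pU₃ , miss = U₁ , U₂ , U₃ , pU₁ , pU₂ , pU₃ , ≢-sym U₂≢U₁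
                         , (λ e → miss (suc zero , e)) , (λ e → miss (zero , e))

  farNeighbour : 1 ≤ s → 1 ≤ t → ∀ x y → y ≢ x → col x y ≡ true →
    ∃[ a ] (col x a ≡ false × col y a ≡ true)
  farNeighbour s≥1 t≥1 x y y≢x xy with collinear-elim xy
  ... | L , xL , yL with otherLine t≥1 y L
  ... | N , yN , N≢L with otherPoint s≥1 N y
  ... | a , aN , a≢y = a , ¬-not x≁a , collinear-intro N yN aN
    where
    xN : I x N ≡ false
    xN = ¬-not (λ e → N≢L (partialLinear x y N L (≢-sym y≢x) e yN xL yL))
    x≁a : col x a ≢ true
    x≁a xa = a≢y (sym (projection-unique x N xN y a yN xy aN xa))

  farPoint : 1 ≤ s → 1 ≤ t → ∀ x → ∃[ z ] col x z ≡ false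
  farPoint s≥1 t≥1 x with someLine x
  ... | L , xL with otherPoint s≥1 L x
  ... | y , yL , y≢x with farNeighbour s≥1 t≥1 x y y≢x (collinear-intro L xL yL)
  ... | z , xz , _ = z , xz

module Acting {np nl s t c ℓ} {S : GQ np nl s t} {H : Group c ℓ} (A : Action S H) where
  open GQ S
  open Group H using (Carrier; _≈_; _∙_; ε; _⁻¹)
  private module G = Group H
  open GroupProperties H using (\\-leftDividesˡ)
  open Action A
  open Geometry S

  act-inverse : ∀ g p → actP (g ⁻¹) (actP g p) ≡ p
  act-inverse g p = trans (sym (actP-∙ (g ⁻¹) g p)) (trans (actP-cong (G.inverseˡ g) p) (actP-ε p))

  actL-inverse : ∀ g L → actL (g ⁻¹) (actL g L) ≡ L
  actL-inverse g L = trans (sym (actL-∙ (g ⁻¹) g L)) (trans (actL-cong (G.inverseˡ g) L) (actL-ε L))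

  act-injective : ∀ g {p q} → actP g p ≡ actP g q → p ≡ q
  act-injective g {p} {q} e = trans (sym (act-inverse g p)) (trans (cong (actP (g ⁻¹)) e) (act-inverse g q))

  act-factor : ∀ a b p → actP b p ≡ actP a (actP (a ⁻¹ ∙ b) p)
  act-factor a b p = trans (actP-cong (G.sym (\\-leftDividesˡ a b)) p) (actP-∙ a (a ⁻¹ ∙ b) p)

  agree⇒fixed : ∀ a b w → actP a w ≡ actP b w → actP (b ⁻¹ ∙ a) w ≡ w
  agree⇒fixed a b w e = trans (actP-∙ (b ⁻¹) a w) (trans (cong (actP (b ⁻¹)) e) (act-inverse b w))

  collinear-preserved : ∀ g {p q} → col p q ≡ true → col (actP g p) (actP g q) ≡ true
  collinear-preserved g {p} {q} e with collinear-elim e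
  ... | L , pL , qL = collinear-intro (actL g L) (trans (preservesI g p L) pL) (trans (preservesI g q L) qL)

  collinear-reflected : ∀ g {p q} → col (actP g p) (actP g q) ≡ true → col p q ≡ true
  collinear-reflected g {p} {q} e =
    subst₂ (λ p q → col p q ≡ true) (act-inverse g p) (act-inverse g q) (collinear-preserved (g ⁻¹) e)

  stab-∙ : ∀ a b {U} → actL a U ≡ U → actL b U ≡ U → actL (a ∙ b) U ≡ U
  stab-∙ a b {U} aU bU = trans (actL-∙ a b U) (trans (cong (actL a) bU) aU)

  stab-⁻¹ : ∀ a {U} → actL a U ≡ U → actL (a ⁻¹) U ≡ U
  stab-⁻¹ a {U} aU = trans (cong (actL (a ⁻¹)) (sym aU)) (actL-inverse a U)

  stab-incident : ∀ a {p U} → actL a U ≡ U → I p U ≡ true → I (actP a p) U ≡ true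
  stab-incident a {p} {U} aU pU = trans (cong (I (actP a p)) (sym aU)) (trans (preservesI a p U) pU)

module Elation {np nl s t c ℓ} {S : GQ np nl s t} {H : Group c ℓ} (A : Action S H)
               (x : Fin np) (E : IsElationGroup A x) (t≥1 : 1 ≤ t) where
  open GQ S
  open Group H using (_≈_)
  private module G = Group H
  open Action A
  open IsElationGroup E
  open Geometry S
  open Acting A

  onLineThroughX : ∀ a {p L} → I x L ≡ true → I p L ≡ true → I (actP a p) L ≡ true
  onLineThroughX a {p} {L} xL pL = stab-incident a (fixesLinesOnX a L xL) pL

  -- x is the intersection of two fixed lines, hence fixed.
  fixesX : ∀ a → actP a x ≡ x
  fixesX a with someLine x
  ... | L₁ , xL₁ with otherLine t≥1 x L₁
  ... | L₂ , xL₂ , L₂≢L₁ with actP a x ≟ x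
  ...   | yes ax≡x = ax≡x
  ...   | no ax≢x = ⊥-elim (L₂≢L₁ (partialLinear (actP a x) x L₂ L₁ ax≢x
            (onLineThroughX a xL₂ xL₂) xL₂ (onLineThroughX a xL₁ xL₁) xL₁))

  perp-preserved : ∀ a {y} → col x y ≡ true → col x (actP a y) ≡ true
  perp-preserved a e = subst (λ w → col w _ ≡ true) (fixesX a) (collinear-preserved a e)

  affine-preserved : ∀ a {y} → col x y ≡ false → col x (actP a y) ≡ false
  affine-preserved a {y} xy = ¬-not (λ e → clash xy
    (collinear-reflected a (subst (λ w → col w (actP a y) ≡ true) (sym (fixesX a)) e)))

  semiregular : ∀ a b y → col x y ≡ false → actP a y ≡ actP b y → a ≈ b
  semiregular a b y xy e with sharplyTransitive y (actP a y) xy (affine-preserved a xy)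
  ... | _ , _ , unique = G.trans (unique a refl) (G.sym (unique b (sym e)))

module STGQ {c ℓ ℓ' : Level} {np nl s t : ℕ}
    (S : GQ np nl s t) (thick : Thick s t S)
    (H : Group c ℓ) (A : Action S H) (x : Fin np) (E : IsElationGroup A x)
    (𝕊 : Group.Carrier H → Set ℓ') (SG : IsSymmetryGroup A x 𝕊) where
  open GQ S
  open Group H using (Carrier; _≈_; _∙_; ε; _⁻¹)
  private module G = Group H
  open GroupProperties H using (\\-leftDividesˡ)
  open Action A
  open IsElationGroup E
  open IsSymmetryGroup SG
  open Geometry S
  open Acting A

  s≥1 : 1 ≤ s
  s≥1 = ≤-trans (n≤1+n 1) (proj₁ thick)

  t≥2 : 2 ≤ t
  t≥2 = proj₂ thick

  t≥1 : 1 ≤ t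
  t≥1 = ≤-trans (n≤1+n 1) t≥2

  open Elation A x E t≥1

  commutator : Carrier → Carrier → Carrier
  commutator g h = (h ∙ g) ⁻¹ ∙ (g ∙ h)

  commutator-fixes : ∀ g h w → actP g (actP h w) ≡ actP h (actP g w) → actP (commutator g h) w ≡ w
  commutator-fixes g h w e = agree⇒fixed (g ∙ h) (h ∙ g) w
    (trans (actP-∙ g h w) (trans e (sym (actP-∙ h g w))))

  commutator≈ε⇒commute : ∀ g h → commutator g h ≈ ε → g ∙ h ≈ h ∙ g
  commutator≈ε⇒commute g h σ≈ε = G.trans (G.sym (\\-leftDividesˡ (h ∙ g) (g ∙ h)))
    (G.trans (G.∙-congˡ σ≈ε) (G.identityʳ (h ∙ g)))

  commute-on-perp : ∀ g h → 𝕊 (commutator g h) → ∀ w → col x w ≡ true →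
    actP g (actP h w) ≡ actP h (actP g w)
  commute-on-perp g h σ∈𝕊 w xw = begin
    actP g (actP h w)                      ≡⟨ sym (actP-∙ g h w) ⟩
    actP (g ∙ h) w                         ≡⟨ act-factor (h ∙ g) (g ∙ h) w ⟩
    actP (h ∙ g) (actP (commutator g h) w) ≡⟨ cong (actP (h ∙ g)) (symmetries σ∈𝕊 w xw) ⟩
    actP (h ∙ g) w                         ≡⟨ actP-∙ h g w ⟩
    actP h (actP g w)                      ∎
    where open ≡-Reasoning

  abelianQuotient⇒star : QuotientAbelian A x 𝕊 → PropertyStar A x
  abelianQuotient⇒star abelian g y y≢x xy gy L xL yL w wL with w ≟ x
  ... | yes refl = fixesX g
  ... | no w≢x with farNeighbour s≥1 t≥1 x y y≢x xy
                  | farNeighbour s≥1 t≥1 x w w≢x (collinear-intro L xL wL)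
  ... | a , xa , ya | b , xb , wb with sharplyTransitive a b xa xb
  ... | h , ha≡b , _ = begin
      actP g w          ≡⟨ cong (actP g) (sym hy≡w) ⟩
      actP g (actP h y) ≡⟨ commute-on-perp g h (abelian g h) y xy ⟩
      actP h (actP g y) ≡⟨ cong (actP h) gy ⟩
      actP h y          ≡⟨ hy≡w ⟩
      w                 ∎
    where
    open ≡-Reasoning
    -- h y is on L and collinear with h a = b, as is w; so they coincide.
    hy≡w : actP h y ≡ w
    hy≡w = projection-unique b L (apart xb xL) (actP h y) w (onLineThroughX h xL yL)
      (subst (λ v → col v (actP h y) ≡ true) ha≡b (collinear-preserved h (collinear-sym ya)))
      wL (collinear-sym wb)

  abelianQuotient⇒kantorAbelian : QuotientAbelian A x 𝕊 → ∀ z → Affine A x z → KantorFamilyAbelian A x z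
  abelianQuotient⇒kantorAbelian abelian z xz U zU g h gU hU with otherLine t≥1 z U
  ... | V , zV , V≢U with projection-exists x V (apart˘ xz zV)
  ... | v , vV , xv = commutator≈ε⇒commute g h σ≈ε
    where
    σ : Carrier
    σ = commutator g h
    σU : actL σ U ≡ U
    σU = stab-∙ ((h ∙ g) ⁻¹) (g ∙ h) (stab-⁻¹ (h ∙ g) (stab-∙ h g hU gU)) (stab-∙ g h gU hU)
    vU : I v U ≡ false
    vU = ¬-not (λ v∈U → V≢U (partialLinear v z V U v≢z vV zV v∈U zU))
      where
      v≢z : v ≢ z
      v≢z e = clash xz (subst (λ w → col x w ≡ true) e xv)
    -- σ fixes v ∈ x^⊥ and stabilises U, so it fixes z, the projection of v on U.
    σz≡z : actP σ z ≡ z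
    σz≡z = projection-unique v U vU (actP σ z) z (stab-incident σ σU zU)
      (subst (λ w → col w (actP σ z) ≡ true) (symmetries (abelian g h) v xv)
        (collinear-preserved σ (collinear-intro V vV zV)))
      zU (collinear-intro V vV zV)
    σ≈ε : σ ≈ ε
    σ≈ε = semiregular σ ε z xz (trans σz≡z (sym (actP-ε z)))

  record Projection (z : Fin np) : Set where
    field
      U M : Fin nl
      u : Fin np
      zU : I z U ≡ true
      uU : I u U ≡ true
      xM : I x M ≡ true
      uM : I u M ≡ true
      u≢x : u ≢ x

  projectionOn : ∀ {z} → col x z ≡ false → ∀ U → I z U ≡ true → Projection z
  projectionOn {z} xz U zU = record
    { U = U ; M = proj₁ xuM ; u = u ; zU = zU ; uU = uU
    ; xM = proj₁ (proj₂ xuM) ; uM = proj₂ (proj₂ xuM)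
    ; u≢x = λ e → clash xU (subst (λ w → I w U ≡ true) e uU) }
    where
    xU : I x U ≡ false
    xU = apart˘ xz zU
    u : Fin np
    u = proj₁ (projection-exists x U xU)
    uU : I u U ≡ true
    uU = proj₁ (proj₂ (projection-exists x U xU))
    xuM : ∃[ M ] (I x M ≡ true × I u M ≡ true)
    xuM = collinear-elim (proj₂ (proj₂ (projection-exists x U xU)))

  x∼u : ∀ {z} (r : Projection z) → col x (Projection.u r) ≡ true
  x∼u r = collinear-intro (Projection.M r) (Projection.xM r) (Projection.uM r)

  z∼u : ∀ {z} (r : Projection z) → col z (Projection.u r) ≡ true
  z∼u r = collinear-intro (Projection.U r) (Projection.zU r) (Projection.uU r)

  module TwoProjections {z : Fin np} (xz : col x z ≡ false)
                        (p q : Projection z) (Up≢Uq : Projection.U p ≢ Projection.U q) where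
    open Projection

    -- Distinct lines through z have distinct feet u_p, u_q; and u_q is off
    -- M_p, since z has only one neighbour u_p on M_p.
    up≢uq : u p ≢ u q
    up≢uq e = Up≢Uq (partialLinear (u p) z (U p) (U q) up≢z (uU p) (zU p)
                       (subst (λ w → I w (U q) ≡ true) (sym e) (uU q)) (zU q))
      where
      up≢z : u p ≢ z
      up≢z e' = clash xz (subst (λ w → col x w ≡ true) e' (x∼u p))

    uq∉Mp : I (u q) (M p) ≡ false
    uq∉Mp = ¬-not (λ e → up≢uq (projection-unique z (M p) (apart xz (xM p)) (u p) (u q)
                                 (uM p) (z∼u p) e (z∼u q)))

    Mp≁uq : ∀ w → I w (M p) ≡ true → w ≢ x → col w (u q) ≡ false
    Mp≁uq w wM w≢x = ¬-not (λ e → w≢x (sym (projection-unique (u q) (M p) uq∉Mp x w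
                        (xM p) (collinear-sym (x∼u q)) wM (collinear-sym e))))

    up≁uq : col (u p) (u q) ≡ false
    up≁uq = Mp≁uq (u p) (uM p) (u≢x p)

    image≁uq : ∀ g → col (actP g (u p)) (u q) ≡ false
    image≁uq g = Mp≁uq (actP g (u p)) (onLineThroughX g (xM p) (uM p))
                   (λ e → u≢x p (act-injective g (trans e (sym (fixesX g)))))

    projection-affine : ∀ g b → I b (U q) ≡ true → col (actP g (u p)) b ≡ true → col x b ≡ false
    projection-affine g b bU gu∼b = ¬-not (λ xb → clash (image≁uq g)
      (subst (λ w → col (actP g (u p)) w ≡ true)
        (sym (projection-unique x (U q) (apart˘ xz (zU q)) (u q) b (uU q) (x∼u q) bU xb)) gu∼b))

    -- H_{u_q} is transitive on the images of u_p: some k fixes u_q and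
    -- maps u_p like g.  (Take k mapping z to the projection b of g u_p on U_q.)
    transitive : ∀ g → ∃[ k ] (actP k (u q) ≡ u q × actP k (u p) ≡ actP g (u p))
    transitive g with projection-exists (actP g (u p)) (U q) (apart˘ (image≁uq g) (uU q))
    ... | b , bU , gu∼b with sharplyTransitive z b xz (projection-affine g b bU gu∼b)
    ... | k , kz≡b , _ = k , kuq≡uq , kup≡gup
      where
      b∉M : ∀ r → I b (M r) ≡ false
      b∉M r = subst (λ w → I w (M r) ≡ false) kz≡b (apart (affine-preserved k xz) (xM r))
      kuq≡uq : actP k (u q) ≡ u q
      kuq≡uq = projection-unique b (M q) (b∉M q) (actP k (u q)) (u q)
        (onLineThroughX k (xM q) (uM q))
        (subst (λ w → col w (actP k (u q)) ≡ true) kz≡b (collinear-preserved k (z∼u q)))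
        (uM q) (collinear-intro (U q) bU (uU q))
      kup≡gup : actP k (u p) ≡ actP g (u p)
      kup≡gup = projection-unique b (M p) (b∉M p) (actP k (u p)) (actP g (u p))
        (onLineThroughX k (xM p) (uM p))
        (subst (λ w → col w (actP k (u p)) ≡ true) kz≡b (collinear-preserved k (z∼u p)))
        (onLineThroughX g (xM p) (uM p)) (collinear-sym gu∼b)

    InT : Fin np → Set
    InT w = col x w ≡ false × col (u p) w ≡ true × col (u q) w ≡ true

    image-in-T : ∀ a → actP a (u p) ≡ u p → actP a (u q) ≡ u q → InT (actP a z)
    image-in-T a ap aq = affine-preserved a xz
      , subst (λ v → col v (actP a z) ≡ true) ap (collinear-preserved a (collinear-sym (z∼u p)))
      , subst (λ v → col v (actP a z) ≡ true) aq (collinear-preserved a (collinear-sym (z∼u q)))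

    -- A line through u_p carries at most one point of T (u_q projects uniquely).
    T-unique-on-line : ∀ w w' N → InT w → InT w' → I (u p) N ≡ true →
      I w N ≡ true → I w' N ≡ true → w ≡ w'
    T-unique-on-line w w' N (_ , _ , uq∼w) (_ , _ , uq∼w') upN wN w'N =
      projection-unique (u q) N (apart up≁uq upN) w w' wN uq∼w w'N uq∼w'

    lineOf : ∀ {w} → InT w → Fin nl
    lineOf T = proj₁ (collinear-elim (proj₁ (proj₂ T)))

    up∈lineOf : ∀ {w} (T : InT w) → I (u p) (lineOf T) ≡ true
    up∈lineOf T = proj₁ (proj₂ (collinear-elim (proj₁ (proj₂ T))))

    w∈lineOf : ∀ {w} (T : InT w) → I w (lineOf T) ≡ true
    w∈lineOf T = proj₂ (proj₂ (collinear-elim (proj₁ (proj₂ T))))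

    lineOf≢Mp : ∀ {w} (T : InT w) → lineOf T ≢ M p
    lineOf≢Mp {w} T e = clash (apart (proj₁ T) (xM p)) (subst (λ L → I w L ≡ true) e (w∈lineOf T))

    same-line⇒equal : ∀ a b (Ta : InT (actP a z)) (Tb : InT (actP b z)) → lineOf Ta ≡ lineOf Tb → a ≈ b
    same-line⇒equal a b Ta Tb e = semiregular a b z xz (T-unique-on-line _ _ (lineOf Tb) Ta Tb
      (up∈lineOf Tb) (subst (λ L → I (actP a z) L ≡ true) e (w∈lineOf Ta)) (w∈lineOf Tb))

    -- The t symmetries give t distinct lines through u_p other than M_p;
    -- together with M_p these are all t + 1 lines through u_p.
    symmetry : Fin t → Carrier
    symmetry = proj₁ order

    symmetry-in-𝕊 : ∀ i → 𝕊 (symmetry i)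
    symmetry-in-𝕊 = proj₁ (proj₂ order)

    symmetry-injective : ∀ i j → symmetry i ≈ symmetry j → i ≡ j
    symmetry-injective = proj₁ (proj₂ (proj₂ order))

    symmetry-T : ∀ i → InT (actP (symmetry i) z)
    symmetry-T i = image-in-T (symmetry i)
      (symmetries (symmetry-in-𝕊 i) (u p) (x∼u p))
      (symmetries (symmetry-in-𝕊 i) (u q) (x∼u q))

    linesAt-up : Fin (suc t) → Fin nl
    linesAt-up = M p ∷ (λ i → lineOf (symmetry-T i))

    linesAt-up-injective : Injective _≡_ _≡_ linesAt-up
    linesAt-up-injective {zero}  {zero}  _ = refl
    linesAt-up-injective {zero}  {suc j} e = ⊥-elim (lineOf≢Mp (symmetry-T j) (sym e))
    linesAt-up-injective {suc i} {zero}  e = ⊥-elim (lineOf≢Mp (symmetry-T i) e)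
    linesAt-up-injective {suc i} {suc j} e = cong suc (symmetry-injective i j
      (same-line⇒equal (symmetry i) (symmetry j) (symmetry-T i) (symmetry-T j) e))

    linesAt-up-incident : ∀ i → I (u p) (linesAt-up i) ≡ true
    linesAt-up-incident zero = uM p
    linesAt-up-incident (suc i) = up∈lineOf (symmetry-T i)

    -- H_{u_p} ∩ H_{u_q} ⊆ 𝕊: the line through u_p and a z is one of the above,
    -- not M_p, so a agrees at z with a symmetry, and equals it.
    stabiliser⊆𝕊 : ∀ a → actP a (u p) ≡ u p → actP a (u q) ≡ u q → 𝕊 a
    stabiliser⊆𝕊 a ap aq = symmetry-line (injection⇒onto (I (u p)) linesAt-up linesAt-up-injective
      linesAt-up-incident (pointLines (u p)) (lineOf Ta) (up∈lineOf Ta))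
      where
      Ta : InT (actP a z)
      Ta = image-in-T a ap aq
      symmetry-line : ∃[ i ] linesAt-up i ≡ lineOf Ta → 𝕊 a
      symmetry-line (zero , e) = ⊥-elim (lineOf≢Mp Ta (sym e))
      symmetry-line (suc i , e) =
        respects (same-line⇒equal (symmetry i) a (symmetry-T i) Ta e) (symmetry-in-𝕊 i)

  module UnderStar (star : PropertyStar A x) {z : Fin np} (xz : col x z ≡ false) where
    open Projection

    fixes-Mp : ∀ a (p : Projection z) → actP a (u p) ≡ u p → ∀ w → I w (M p) ≡ true → actP a w ≡ w
    fixes-Mp a p ap = star a (u p) (u≢x p) (x∼u p) ap (M p) (xM p) (uM p)

    agree-on-Mp : ∀ a b (p : Projection z) → actP a (u p) ≡ actP b (u p) →
      ∀ w → I w (M p) ≡ true → actP a w ≡ actP b w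
    agree-on-Mp a b p e w wM =
      trans (act-factor b a w) (cong (actP b) (fixes-Mp (b ⁻¹ ∙ a) p (agree⇒fixed a b (u p) e) w wM))

    -- For distinct U_p, U_q, the groups H_{u_p} and H_{u_q} commute on x^⊥:
    -- a ∈ H_{u_p} fixes M_p and b ∈ H_{u_q} fixes M_q pointwise, so [a,b]
    -- fixes u_p and u_q and is therefore a symmetry.
    commute-on-perp-under-star : ∀ (p q : Projection z) → U p ≢ U q →
      ∀ a b → actP a (u p) ≡ u p → actP b (u q) ≡ u q →
      ∀ w → col x w ≡ true → actP a (actP b w) ≡ actP b (actP a w)
    commute-on-perp-under-star p q Up≢Uq a b ap bq =
      commute-on-perp a b (TwoProjections.stabiliser⊆𝕊 xz p q Up≢Uq (commutator a b)
        (commutator-fixes a b (u p) (trans (fixes-Mp a p ap _ (onLineThroughX b (xM p) (uM p)))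
                                            (cong (actP b) (sym ap))))
        (commutator-fixes a b (u q) (trans (cong (actP a) bq)
                                            (sym (fixes-Mp b q bq _ (onLineThroughX a (xM q) (uM q)))))))

    -- Replace g, h by gᵣ, hᵣ ∈ H_{u_r} agreeing with them at u_p, write
    -- hᵣ = d e with d ∈ H_{u_p} and e ∈ H_{u_q}, and commute gᵣ past d and e.
    commute-at-projection : (p q r : Projection z) → U p ≢ U q → U q ≢ U r → U p ≢ U r →
      ∀ g h → actP g (actP h (u p)) ≡ actP h (actP g (u p))
    commute-at-projection p q r Up≢Uq Uq≢Ur Up≢Ur g h = begin
      actP g (actP h up)            ≡⟨ cong (actP g) (sym hᵣp) ⟩
      actP g (actP hᵣ up)           ≡⟨ agree-on-Mp g gᵣ p (sym gᵣp) (actP hᵣ up) (onLineThroughX hᵣ (xM p) (uM p)) ⟩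
      actP gᵣ (actP hᵣ up)          ≡⟨ cong (actP gᵣ) (act-factor d hᵣ up) ⟩
      actP gᵣ (actP d (actP e up))  ≡⟨ commute-on-perp-under-star r p (≢-sym Up≢Ur) gᵣ d gᵣr dp
                                         (actP e up) (perp-preserved e (x∼u p)) ⟩
      actP d (actP gᵣ (actP e up))  ≡⟨ cong (actP d) (commute-on-perp-under-star r q (≢-sym Uq≢Ur) gᵣ e gᵣr eq
                                         up (x∼u p)) ⟩
      actP d (actP e (actP gᵣ up))  ≡⟨ sym (act-factor d hᵣ (actP gᵣ up)) ⟩
      actP hᵣ (actP gᵣ up)          ≡⟨ agree-on-Mp hᵣ h p hᵣp (actP gᵣ up) (onLineThroughX gᵣ (xM p) (uM p)) ⟩
      actP h (actP gᵣ up)           ≡⟨ cong (actP h) gᵣp ⟩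
      actP h (actP g up)            ∎
      where
      open ≡-Reasoning
      up : Fin np
      up = u p
      gᵣ-spec : ∃[ k ] (actP k (u r) ≡ u r × actP k up ≡ actP g up)
      gᵣ-spec = TwoProjections.transitive xz p r Up≢Ur g
      hᵣ-spec : ∃[ k ] (actP k (u r) ≡ u r × actP k up ≡ actP h up)
      hᵣ-spec = TwoProjections.transitive xz p r Up≢Ur h
      gᵣ hᵣ : Carrier
      gᵣ = proj₁ gᵣ-spec
      hᵣ = proj₁ hᵣ-spec
      gᵣr : actP gᵣ (u r) ≡ u r
      gᵣr = proj₁ (proj₂ gᵣ-spec)
      gᵣp : actP gᵣ up ≡ actP g up
      gᵣp = proj₂ (proj₂ gᵣ-spec)
      hᵣp : actP hᵣ up ≡ actP h up
      hᵣp = proj₂ (proj₂ hᵣ-spec)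
      -- d ∈ H_{u_p} agrees with hᵣ at u_q, so e = d⁻¹ hᵣ ∈ H_{u_q}.
      d-spec : ∃[ k ] (actP k up ≡ up × actP k (u q) ≡ actP hᵣ (u q))
      d-spec = TwoProjections.transitive xz q p (≢-sym Up≢Uq) hᵣ
      d e : Carrier
      d = proj₁ d-spec
      e = d ⁻¹ ∙ hᵣ
      dp : actP d up ≡ up
      dp = proj₁ (proj₂ d-spec)
      eq : actP e (u q) ≡ u q
      eq = agree⇒fixed hᵣ d (u q) (sym (proj₂ (proj₂ d-spec)))

  -- (*) ⇒ H/𝕊 abelian: [g,h] fixes the projections u₁, u₂ of an affine
  -- point along two of three distinct lines, so it lies in 𝕊.
  star⇒abelianQuotient : PropertyStar A x → QuotientAbelian A x 𝕊
  star⇒abelianQuotient star g h with farPoint s≥1 t≥1 x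
  ... | z , xz with threeLines t≥2 z
  ... | U₁ , U₂ , U₃ , zU₁ , zU₂ , zU₃ , U₁≢U₂ , U₂≢U₃ , U₁≢U₃ =
    TwoProjections.stabiliser⊆𝕊 xz p₁ p₂ U₁≢U₂ (commutator g h)
      (commutator-fixes g h _ (commute-at-projection p₁ p₂ p₃ U₁≢U₂ U₂≢U₃ U₁≢U₃ g h))
      (commutator-fixes g h _ (commute-at-projection p₂ p₁ p₃ (≢-sym U₁≢U₂) U₁≢U₃ U₂≢U₃ g h))
    where
    open UnderStar star xz
    p₁ p₂ p₃ : Projection z
    p₁ = projectionOn xz U₁ zU₁
    p₂ = projectionOn xz U₂ zU₂
    p₃ = projectionOn xz U₃ zU₃

mainTheorem5 : ∀ {c ℓ ℓ' : Level} {np nl s t : ℕ}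
    (S : GQ np nl s t) → Thick s t S →
    (H : Group c ℓ) (A : Action S H) (x : Fin np) →
    IsElationGroup A x →
    (𝕊 : Group.Carrier H → Set ℓ') → IsSymmetryGroup A x 𝕊 →
    (PropertyStar A x ⇔ QuotientAbelian A x 𝕊)
    × ((PropertyStar A x ⊎ QuotientAbelian A x 𝕊) →
       ∀ z → Affine A x z → KantorFamilyAbelian A x z)
mainTheorem5 S thick H A x E 𝕊 SG =
  mk⇔ star⇒abelianQuotient abelianQuotient⇒star ,
  [ abelianQuotient⇒kantorAbelian ∘ star⇒abelianQuotient , abelianQuotient⇒kantorAbelian ]′
  where open STGQ S thick H A x E 𝕊 SG
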